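{- In the setting described in the context, for each facet $\tau$ of $\Lambda$, $\deg(\Phi(\tau))=|\mathcal{R}_{\mathrm{Lex}}(\tau)|$.
   Context: Let $\mathbf{V}=\mathbf{V}_1\cup\cdots\cup\mathbf{V}_m$ (pairwise disjoint finite sets), $\mathbf{a}=(a_1,\ldots,a_m)$ nonnegative integers with $a_i\le|\mathbf{V}_i|$, $1\le d\le\sum_i a_i$. $\Lambda$: simplicial complex on $\mathbf{V}$ with faces the $\tau\subseteq\mathbf{V}$ such that $|\tau\cap\mathbf{V}_i|\le a_i$ for all $i$ and $|\tau|\le d$; facets = faces of size $d$. Order $\mathbf{V}$ by $\succ$ with all of $\mathbf{V}_i$ before $\mathbf{V}_j$ for $i<j$; write $\mathbf{V}_i=\{v^i_1\succ v^i_2\succ\cdots\}$; subsets inherit $\succ$. Revlex on equal-size sets: $S\succ T$ if the $\succ$-least element of the symmetric difference lies in $T$. $\mathcal{R}_{\mathrm{Lex}}(\tau)=\{v\in\tau:\tau-\{v\}\subseteq\tau'\text{ for some facet }\tau'\succ\tau\}$. Variables: $\mathbf{X}_i=\{x^i_1\succ\cdots\succ x^i_{|\mathbf{V}_i|-a_i}\}$ ($1\le i\le m$), $\mathbf{X}_0=\{x^0_1\succ\cdots\succ x^0_c\}$ with $c=(\sum a_i)-d$. For a totally ordered $V=\{v_1\succ\cdots\succ v_N\}$, $0\le a\le N$, $X=\{x_1\succ\cdots\succ x_{N-a}\}$: $\phi(V,X)$ sends an $a$-subset $\tau=\{v_1,\ldots,v_t,v_{i_1},\ldots,v_{i_s}\}$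 ($t+s=a$, $t+1<i_1<\cdots<i_s$) to $x_{i_1-(t+1)}\cdots x_{i_s-(t+s)}$. $\Phi$: for a facet $\tau$ and $1\le i\le m$, $\mathrm{fill}_i(\tau)$ is the revlex-first $a_i$-subset of $\mathbf{V}_i$ containing $\tau\cap\mathbf{V}_i$, $\Phi_i(\tau)=\phi(\mathbf{V}_i,\mathbf{X}_i)(\mathrm{fill}_i(\tau))$; $\mathbf{V}[\tau]$ consists of the $\succ$-first $a_i-\deg\Phi_i(\tau)$ elements of each $\mathbf{V}_i$; $\tau[0]=\tau\cap\mathbf{V}[\tau]$ (one has $|\mathbf{V}[\tau]|-|\tau[0]|=|\mathbf{X}_0|$); $\Phi_0(\tau)=\phi(\mathbf{V}[\tau],\mathbf{X}_0)(\tau[0])$; $\Phi(\tau)=\prod_{i=0}^m\Phi_i(\tau)$. -}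

module Defs where

open import Data.Nat using (ℕ; zero; suc; _+_; _∸_; _≤_; _<_)
open import Data.Fin using (Fin; toℕ)
open import Data.Bool using (Bool; true; false; if_then_else_)
open import Data.Nat.ListAction using (sum)
open import Data.List using (List; []; _∷_; _++_; length; tabulate; take; concat; map)
open import Data.Product using (Σ; _×_; _,_; ∃)
open import Data.Sum using (_⊎_)
open import Relation.Binary.PropositionalEquality using (_≡_; _≢_)

sumFin : ∀ {k} → (Fin k → ℕ) → ℕ
sumFin f = sum (tabulate f)

countFin : ∀ {k} → (Fin k → Bool) → ℕ
countFin f = sumFin (λ j → if f j then 1 else 0)

-- Revlex on subsets of a totally ordered set Fin k, ordered v_0 ≻ v_1 ≻ ⋯ (index order).
-- S ≻ T iff the ≻-least (= largest-index) element j of the symmetric difference lies in T.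
RevlexGtFin : ∀ {k} → (Fin k → Bool) → (Fin k → Bool) → Set
RevlexGtFin {k} S T =
  Σ (Fin k) λ j → T j ≡ true × S j ≡ false × (∀ (j' : Fin k) → toℕ j < toℕ j' → S j' ≡ T j')

-- The map φ(V,X): input the characteristic list of an a-subset τ of V = {v_1 ≻ ⋯ ≻ v_N}
-- (listed in ≻-order); output the monomial x_{i_1-(t+1)} ⋯ x_{i_s-(t+s)} as the list
-- of its variable indices [i_1-(t+1), …, i_s-(t+s)] (a monomial = multiset of variables).
module PhiImpl where
  -- rest i c bs : i = 1-based position of the head of bs, c = number of τ-elements before it
  rest : ℕ → ℕ → List Bool → List ℕ
  rest i c [] = []
  rest i c (true ∷ bs) = (i ∸ suc c) ∷ rest (suc i) (suc c) bs
  rest i c (false ∷ bs) = rest (suc i) c bs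

  -- initial i bs : still inside the initial segment v_1,…,v_t ⊆ τ ; i = 1-based position
  initial : ℕ → List Bool → List ℕ
  initial i [] = []
  initial i (true ∷ bs) = initial (suc i) bs
  initial i (false ∷ bs) = rest (suc i) (i ∸ 1) bs

φ : List Bool → List ℕ
φ = PhiImpl.initial 1

module Setup (m : ℕ) (n : Fin m → ℕ) (a : Fin m → ℕ) (d : ℕ) where

  -- Vertices: v^i_{j+1} is represented by (i , j).
  Vtx : Set
  Vtx = Σ (Fin m) λ i → Fin (n i)

  VSubset : Set
  VSubset = Vtx → Bool

  -- w comes strictly after v in ≻ (i.e. v ≻ w): blocks in order, then indices in order.
  After : Vtx → Vtx → Set
  After (i , j) (i' , j') = toℕ i < toℕ i' ⊎ (i ≡ i' × toℕ j < toℕ j')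

  blockCount : VSubset → Fin m → ℕ
  blockCount τ i = countFin (λ j → τ (i , j))

  size : VSubset → ℕ
  size τ = sumFin (blockCount τ)

  IsFacet : VSubset → Set
  IsFacet τ = (∀ i → blockCount τ i ≤ a i) × size τ ≡ d

  RevlexGt : VSubset → VSubset → Set
  RevlexGt S T = Σ Vtx λ v → T v ≡ true × S v ≡ false × (∀ w → After v w → S w ≡ T w)

  RLex : VSubset → Vtx → Set
  RLex τ v = τ v ≡ true ×
    Σ VSubset λ τ' → IsFacet τ' × RevlexGt τ' τ × (∀ w → τ w ≡ true → w ≢ v → τ' w ≡ true)

  IsFill : VSubset → (i : Fin m) → (Fin (n i) → Bool) → Set
  IsFill τ i F =
    countFin F ≡ a i × (∀ j → τ (i , j) ≡ true → F j ≡ true) ×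
    (∀ (G : Fin (n i) → Bool) → countFin G ≡ a i → (∀ j → τ (i , j) ≡ true → G j ≡ true) →
       (∀ j → G j ≡ F j) ⊎ RevlexGtFin F G)

  Φi : (F : (i : Fin m) → Fin (n i) → Bool) → (i : Fin m) → List ℕ
  Φi F i = φ (tabulate (F i))

  -- characteristic list of τ[0] = τ ∩ V[τ] inside V[τ] (listed in ≻-order), where V[τ]
  -- consists of the ≻-first a_i - deg Φ_i(τ) elements of each V_i.
  τ0list : (F : (i : Fin m) → Fin (n i) → Bool) → VSubset → List Bool
  τ0list F τ = concat (tabulate λ i → take (a i ∸ length (Φi F i)) (tabulate (λ j → τ (i , j))))

  Φ0 : (F : (i : Fin m) → Fin (n i) → Bool) → VSubset → List ℕ
  Φ0 F τ = φ (τ0list F τ)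

  -- Φ(τ) = ∏_{i=0}^m Φ_i(τ) as a list of variables (block index, variable index);
  -- block 0 is X_0, block suc (toℕ i) is X_i.
  Φ : (F : (i : Fin m) → Fin (n i) → Bool) → VSubset → List (ℕ × ℕ)
  Φ F τ = map (λ k → (0 , k)) (Φ0 F τ) ++ concat (tabulate λ i → map (λ k → (suc (toℕ i) , k)) (Φi F i))

  degΦ : (F : (i : Fin m) → Fin (n i) → Bool) → VSubset → ℕ
  degΦ F τ = length (Φ F τ)

  HasCard : (Vtx → Set) → ℕ → Set
  HasCard P k = Σ VSubset λ χ → (∀ v → (χ v ≡ true → P v) × (P v → χ v ≡ true)) × size χ ≡ k

-- A vertex v = v^i_j of a facet τ lies in R_Lex(τ) iff some v^i_{j'} with j' < j is missing from τ,
-- or some earlier block has |τ ∩ V_{i'}| < a_{i'}: then v can be traded for that missing vertex, and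
-- conversely any vertex of τ' ∖ τ for a revlex-larger facet τ' ⊇ τ - v must be such a vertex. Since fill_i(τ) is revlex-first, it agrees with τ after its first
-- gap, so the elements of τ ∩ V_i beyond the leading run of the fill number deg Φ_i(τ). The elements
-- inside that run form τ[0] ∩ V_i; all of them count if an earlier block is deficient, otherwise
-- only those after the leading run of τ[0] ∩ V_i. Since a block of τ[0] is incomplete exactly when
-- that block of τ is deficient, these contributions add up to deg φ(V[τ], X_0)(τ[0]).
module Submission where

open import Defs
open import Data.Nat as ℕ using (ℕ; zero; suc; _+_; _∸_; _≤_; _<_; z≤n; s≤s; _<ᵇ_)
open import Data.Nat.Properties
open import Data.Nat.ListAction using (sum)
open import Data.Fin using (Fin; toℕ; zero; suc)
open import Data.Fin.Properties using (any?) renaming (_≟_ to _≟ᶠ_; suc-injective to fsuc-injective; <-cmp to <-cmpᶠ)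
open import Data.Bool using (Bool; true; false; if_then_else_; not; _∧_; _∨_)
open import Data.Bool.Properties using (∧-zeroʳ; ∧-identityʳ; ∨-zeroʳ; ∧-conicalˡ; ∧-conicalʳ; not-involutive; not-injective; ¬-not; T-≡) renaming (_≟_ to _≟ᵇ_)
open import Data.List using (List; []; _∷_; _++_; length; tabulate; take; concat; map)
open import Data.Bool.ListAction using (and)
open import Data.List.Properties using (tabulate-cong; length-++; length-map)
open import Data.Product using (_×_; _,_; _,′_; ∃; proj₁; proj₂)
open import Data.Product.Properties using (≡-dec)
open import Data.Sum using (_⊎_; inj₁; inj₂; [_,_]′)
open import Data.Empty using (⊥-elim)
open import Function using (_∘_; case_of_)
open import Function.Bundles using (Equivalence)
open import Relation.Nullary using (¬_; yes; no)
open import Relation.Nullary.Decidable using (isYes)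
open import Relation.Binary using (tri<; tri≈; tri>)
open import Relation.Binary.Definitions using (DecidableEquality)
open import Relation.Binary.PropositionalEquality hiding ([_])
open import Algebra.Properties.CommutativeSemigroup +-commutativeSemigroup using (interchange; xy∙z≈xz∙y)

∧-intro : ∀ {x y} → x ≡ true → y ≡ true → x ∧ y ≡ true
∧-intro refl refl = refl

∨-introˡ : ∀ {x} y → x ≡ true → x ∨ y ≡ true
∨-introˡ y refl = refl

∨-introʳ : ∀ x {y} → y ≡ true → x ∨ y ≡ true
∨-introʳ x refl = ∨-zeroʳ x

ind : Bool → ℕ
ind b = if b then 1 else 0

trues : List Bool → ℕ
trues []       = 0
trues (b ∷ bs) = ind b + trues bs

leadingTrues : List Bool → ℕ
leadingTrues []           = 0
leadingTrues (true ∷ bs)  = suc (leadingTrues bs)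
leadingTrues (false ∷ bs) = 0

nonLeadingTrues : List Bool → ℕ
nonLeadingTrues []           = 0
nonLeadingTrues (true ∷ bs)  = nonLeadingTrues bs
nonLeadingTrues (false ∷ bs) = trues bs

length-φ : ∀ bs → length (φ bs) ≡ nonLeadingTrues bs
length-φ = length-initial 1
  where
  open PhiImpl
  length-rest : ∀ i c bs → length (rest i c bs) ≡ trues bs
  length-rest i c []           = refl
  length-rest i c (true ∷ bs)  = cong suc (length-rest (suc i) (suc c) bs)
  length-rest i c (false ∷ bs) = length-rest (suc i) c bs

  length-initial : ∀ i bs → length (initial i bs) ≡ nonLeadingTrues bs
  length-initial i []           = refl
  length-initial i (true ∷ bs)  = length-initial (suc i) bs
  length-initial i (false ∷ bs) = length-rest (suc i) (i ∸ 1) bs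

trues≡leading+nonLeading : ∀ bs → trues bs ≡ leadingTrues bs + nonLeadingTrues bs
trues≡leading+nonLeading []           = refl
trues≡leading+nonLeading (true ∷ bs)  = cong suc (trues≡leading+nonLeading bs)
trues≡leading+nonLeading (false ∷ bs) = refl

trues-++ : ∀ xs ys → trues (xs ++ ys) ≡ trues xs + trues ys
trues-++ []       ys = refl
trues-++ (x ∷ xs) ys = trans (cong (ind x +_) (trues-++ xs ys)) (sym (+-assoc (ind x) _ _))

nonLeadingTrues-++ : ∀ xs ys →
  nonLeadingTrues (xs ++ ys) ≡ nonLeadingTrues xs + (if and xs then nonLeadingTrues ys else trues ys)
nonLeadingTrues-++ []           ys = refl
nonLeadingTrues-++ (true ∷ xs)  ys = nonLeadingTrues-++ xs ys
nonLeadingTrues-++ (false ∷ xs) ys = trues-++ xs ys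

sumFin-cong : ∀ {k} {f g : Fin k → ℕ} → (∀ j → f j ≡ g j) → sumFin f ≡ sumFin g
sumFin-cong e = cong sum (tabulate-cong e)

sumFin-+ : ∀ {k} (f g : Fin k → ℕ) → sumFin (λ j → f j + g j) ≡ sumFin f + sumFin g
sumFin-+ {zero}  f g = refl
sumFin-+ {suc k} f g = trans (cong (f zero + g zero +_) (sumFin-+ (f ∘ suc) (g ∘ suc)))
  (interchange (f zero) (g zero) (sumFin (f ∘ suc)) (sumFin (g ∘ suc)))

sumFin-mono : ∀ {k} {f g : Fin k → ℕ} → (∀ j → f j ≤ g j) → sumFin f ≤ sumFin g
sumFin-mono {zero}  e = z≤n
sumFin-mono {suc k} e = +-mono-≤ (e zero) (sumFin-mono (e ∘ suc))

sumFin-bumpAt : ∀ {k} (g h : Fin k → ℕ) (j : Fin k) {δ} → (∀ j' → j' ≢ j → g j' ≡ h j') → g j + δ ≡ h j →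
                sumFin g + δ ≡ sumFin h
sumFin-bumpAt g h zero {δ} same bumped = begin
  g zero + sumFin (g ∘ suc) + δ ≡⟨ xy∙z≈xz∙y (g zero) _ δ ⟩
  g zero + δ + sumFin (g ∘ suc) ≡⟨ cong₂ _+_ bumped (sumFin-cong λ j → same (suc j) λ ()) ⟩
  h zero + sumFin (h ∘ suc)     ∎
  where open ≡-Reasoning
sumFin-bumpAt g h (suc j) {δ} same bumped = begin
  g zero + sumFin (g ∘ suc) + δ   ≡⟨ +-assoc (g zero) _ δ ⟩
  g zero + (sumFin (g ∘ suc) + δ) ≡⟨ cong₂ _+_ (same zero λ ()) (sumFin-bumpAt (g ∘ suc) (h ∘ suc) j same' bumped) ⟩
  h zero + sumFin (h ∘ suc)       ∎
  where
  open ≡-Reasoning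
  same' : ∀ j' → j' ≢ j → g (suc j') ≡ h (suc j')
  same' j' j'≢j = same (suc j') (j'≢j ∘ fsuc-injective)

_⊆_ : ∀ {k} → (Fin k → Bool) → (Fin k → Bool) → Set
f ⊆ g = ∀ j → f j ≡ true → g j ≡ true

⊆-false : ∀ {k} {f g : Fin k → Bool} → f ⊆ g → ∀ j → g j ≡ false → f j ≡ false
⊆-false f⊆g j gj = ¬-not λ fj → case trans (sym (f⊆g j fj)) gj of λ ()

countFin≡trues : ∀ {k} (f : Fin k → Bool) → countFin f ≡ trues (tabulate f)
countFin≡trues {zero}  f = refl
countFin≡trues {suc k} f = cong (ind (f zero) +_) (countFin≡trues (f ∘ suc))

countFin-cong : ∀ {k} {f g : Fin k → Bool} → (∀ j → f j ≡ g j) → countFin f ≡ countFin g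
countFin-cong e = sumFin-cong (λ j → cong ind (e j))

countFin-allTrue : ∀ {k} {f : Fin k → Bool} → (∀ j → f j ≡ true) → countFin f ≡ k
countFin-allTrue {zero}      e = refl
countFin-allTrue {suc k} {f} e rewrite e zero = cong suc (countFin-allTrue (e ∘ suc))

countFin-allFalse : ∀ {k} {f : Fin k → Bool} → (∀ j → f j ≡ false) → countFin f ≡ 0
countFin-allFalse {zero}      e = refl
countFin-allFalse {suc k} {f} e rewrite e zero = countFin-allFalse (e ∘ suc)

countFin-split : ∀ {k} (f p : Fin k → Bool) →
  countFin f ≡ countFin (λ j → f j ∧ p j) + countFin (λ j → f j ∧ not (p j))
countFin-split f p = trans (sumFin-cong λ j → ind-split (f j) (p j))
                           (sumFin-+ (λ j → ind (f j ∧ p j)) (λ j → ind (f j ∧ not (p j))))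
  where
  ind-split : ∀ x y → ind x ≡ ind (x ∧ y) + ind (x ∧ not y)
  ind-split true  true  = refl
  ind-split true  false = refl
  ind-split false y     = refl

ind-mono : ∀ {x y} → (x ≡ true → y ≡ true) → ind x ≤ ind y
ind-mono {false} h = z≤n
ind-mono {true}  h rewrite h refl = s≤s z≤n

countFin-mono : ∀ {k} {f g : Fin k → Bool} → f ⊆ g → countFin f ≤ countFin g
countFin-mono f⊆g = sumFin-mono (λ j → ind-mono (f⊆g j))

countFin-strict : ∀ {k} {f g : Fin k → Bool} → f ⊆ g → (j : Fin k) → f j ≡ false → g j ≡ true →
                  countFin f < countFin g
countFin-strict {suc k} {f} {g} f⊆g zero fj gj rewrite fj | gj = s≤s (countFin-mono (f⊆g ∘ suc))
countFin-strict {suc k} f⊆g (suc j) fj gj =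
  +-mono-≤-< (ind-mono (f⊆g zero)) (countFin-strict (f⊆g ∘ suc) j fj gj)

countFin<⇒∃false : ∀ {k} (f : Fin k → Bool) → countFin f < k → ∃ λ j → f j ≡ false
countFin<⇒∃false f |f|<k with any? (λ j → f j ≟ᵇ false)
... | yes found = found
... | no  none  = ⊥-elim (<-irrefl (countFin-allTrue (λ j → ¬-not (λ fj → none (j , fj)))) |f|<k)

anyBefore : ∀ {k} → (Fin k → Bool) → Fin k → Bool
anyBefore f zero    = false
anyBefore f (suc j) = f zero ∨ anyBefore (f ∘ suc) j

anyBefore-sound : ∀ {k} (f : Fin k → Bool) (j : Fin k) → anyBefore f j ≡ true →
                  ∃ λ j' → toℕ j' < toℕ j × f j' ≡ true
anyBefore-sound f (suc j) p with f zero in f₀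
... | true  = zero , s≤s z≤n , f₀
... | false with anyBefore-sound (f ∘ suc) j p
...   | j' , j'<j , fj' = suc j' , s≤s j'<j , fj'

anyBefore-complete : ∀ {k} (f : Fin k → Bool) (j j' : Fin k) → toℕ j' < toℕ j → f j' ≡ true →
                     anyBefore f j ≡ true
anyBefore-complete f (suc j) zero     j'<j       fj' rewrite fj' = refl
anyBefore-complete f (suc j) (suc j') (s≤s j'<j) fj' with f zero
... | true  = refl
... | false = anyBefore-complete (f ∘ suc) j j' j'<j fj'

anyBefore-cong : ∀ {k} {f g : Fin k → Bool} → (∀ j → f j ≡ g j) → ∀ j → anyBefore f j ≡ anyBefore g j
anyBefore-cong e zero    = refl
anyBefore-cong e (suc j) = cong₂ _∨_ (e zero) (anyBefore-cong (e ∘ suc) j)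

gapBefore : ∀ {k} → (Fin k → Bool) → Fin k → Bool
gapBefore f = anyBefore (not ∘ f)

gapped : ∀ {k} → (Fin k → Bool) → Fin k → Bool
gapped f j = f j ∧ gapBefore f j

gapBefore-sound : ∀ {k} (f : Fin k → Bool) (j : Fin k) → gapBefore f j ≡ true →
                  ∃ λ j' → toℕ j' < toℕ j × f j' ≡ false
gapBefore-sound f j p with anyBefore-sound (not ∘ f) j p
... | j' , j'<j , nfj' = j' , j'<j , not-injective nfj'

gapBefore-complete : ∀ {k} (f : Fin k → Bool) (j j' : Fin k) → toℕ j' < toℕ j → f j' ≡ false →
                     gapBefore f j ≡ true
gapBefore-complete f j j' j'<j fj' = anyBefore-complete (not ∘ f) j j' j'<j (cong not fj')

gapBefore-antitone : ∀ {k} {f g : Fin k → Bool} → f ⊆ g → ∀ j → gapBefore g j ≡ true → gapBefore f j ≡ true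
gapBefore-antitone {f = f} {g} f⊆g j gap with gapBefore-sound g j gap
... | j' , j'<j , gj' = gapBefore-complete f j j' j'<j (⊆-false f⊆g j' gj')

trues-concat : ∀ {k} (B : Fin k → List Bool) → trues (concat (tabulate B)) ≡ sumFin (trues ∘ B)
trues-concat {zero}  B = refl
trues-concat {suc k} B = trans (trues-++ (B zero) _) (cong (trues (B zero) +_) (trues-concat (B ∘ suc)))

nonLeadingTrues-concat : ∀ {k} (B : Fin k → List Bool) →
  nonLeadingTrues (concat (tabulate B)) ≡
  sumFin (λ i → if anyBefore (not ∘ and ∘ B) i then trues (B i) else nonLeadingTrues (B i))
nonLeadingTrues-concat {zero}  B = refl
nonLeadingTrues-concat {suc k} B
  rewrite nonLeadingTrues-++ (B zero) (concat (tabulate (B ∘ suc))) with and (B zero)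
... | true  = cong (nonLeadingTrues (B zero) +_) (nonLeadingTrues-concat (B ∘ suc))
... | false = cong (nonLeadingTrues (B zero) +_) (trues-concat (B ∘ suc))

length-concat : ∀ {A : Set} {k} (G : Fin k → List A) → length (concat (tabulate G)) ≡ sumFin (length ∘ G)
length-concat {k = zero}  G = refl
length-concat {k = suc k} G = trans (length-++ (G zero)) (cong (length (G zero) +_) (length-concat (G ∘ suc)))

module _ {A : Set} (_≟_ : DecidableEquality A) where

  update : (A → Bool) → A → Bool → A → Bool
  update f x b y = if isYes (y ≟ x) then b else f y

  update-same : ∀ f x b → update f x b x ≡ b
  update-same f x b with x ≟ x
  ... | yes _  = refl
  ... | no x≢x = ⊥-elim (x≢x refl)

  update-other : ∀ f x b y → y ≢ x → update f x b y ≡ f y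
  update-other f x b y y≢x with y ≟ x
  ... | yes y≡x = ⊥-elim (y≢x y≡x)
  ... | no _    = refl

countFin-remove : ∀ {k} (f : Fin k → Bool) j → f j ≡ true → countFin (update _≟ᶠ_ f j false) + 1 ≡ countFin f
countFin-remove f j fj = sumFin-bumpAt (ind ∘ update _≟ᶠ_ f j false) (ind ∘ f) j
  (λ j' j'≢j → cong ind (update-other _≟ᶠ_ f j false j' j'≢j))
  (trans (cong (λ b → ind b + 1) (update-same _≟ᶠ_ f j false)) (cong ind (sym fj)))

countFin-insert : ∀ {k} (f : Fin k → Bool) j → f j ≡ false → countFin f + 1 ≡ countFin (update _≟ᶠ_ f j true)
countFin-insert f j fj = sumFin-bumpAt (ind ∘ f) (ind ∘ update _≟ᶠ_ f j true) j
  (λ j' j'≢j → cong ind (sym (update-other _≟ᶠ_ f j true j' j'≢j)))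
  (trans (cong (λ b → ind b + 1) fj) (cong ind (sym (update-same _≟ᶠ_ f j true))))

IsRevlexFirst : ∀ {k} → (Fin k → Bool) → (Fin k → Bool) → ℕ → Set
IsRevlexFirst t F A = ∀ G → countFin G ≡ A → t ⊆ G → (∀ j → G j ≡ F j) ⊎ RevlexGtFin F G

-- Otherwise moving an element of F that follows a gap into that gap would give a revlex-earlier candidate.
revlexFirst-gapped⊆ : ∀ {k} (t F : Fin k → Bool) (A : ℕ) → countFin F ≡ A → t ⊆ F → IsRevlexFirst t F A →
  gapped F ⊆ t
revlexFirst-gapped⊆ t F A |F| t⊆F first j gappedj with t j in tj
... | true  = refl
... | false with gapBefore-sound F j (∧-conicalʳ (F j) _ gappedj)
...   | j' , j'<j , Fj' = ⊥-elim (not-earlier (first G |G| t⊆G))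
  where
  Fj : F j ≡ true
  Fj = ∧-conicalˡ (F j) _ gappedj

  j'≢j : j' ≢ j
  j'≢j refl = <-irrefl refl j'<j

  F₁ = update _≟ᶠ_ F j false
  G  = update _≟ᶠ_ F₁ j' true

  G-other : ∀ x → x ≢ j' → x ≢ j → G x ≡ F x
  G-other x x≢j' x≢j = trans (update-other _≟ᶠ_ F₁ j' true x x≢j') (update-other _≟ᶠ_ F j false x x≢j)

  Gj : G j ≡ false
  Gj = trans (update-other _≟ᶠ_ F₁ j' true j (j'≢j ∘ sym)) (update-same _≟ᶠ_ F j false)

  |G| : countFin G ≡ A
  |G| = trans (sym (countFin-insert F₁ j' (trans (update-other _≟ᶠ_ F j false j' j'≢j) Fj')))
              (trans (countFin-remove F j Fj) |F|)

  t⊆G : t ⊆ G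
  t⊆G x tx = case ((x ≟ᶠ j') , (x ≟ᶠ j)) of λ where
    (yes refl , _)          → update-same _≟ᶠ_ F₁ j' true
    (no _     , yes refl)   → case trans (sym tx) tj of λ ()
    (no x≢j'  , no x≢j)     → trans (G-other x x≢j' x≢j) (t⊆F x tx)

  not-earlier : ¬ ((∀ x → G x ≡ F x) ⊎ RevlexGtFin F G)
  not-earlier (inj₁ G≗F) = case trans (sym Gj) (trans (G≗F j) Fj) of λ ()
  not-earlier (inj₂ (x , Gx , Fx , above)) = case ((x ≟ᶠ j') , (x ≟ᶠ j)) of λ where
    (yes refl , _)        → case trans (sym Gj) (trans (sym (above j j'<j)) Fj) of λ ()
    (no _     , yes refl) → case trans (sym Gj) Gx of λ ()
    (no x≢j'  , no x≢j)   → case trans (sym Fx) (trans (sym (G-other x x≢j' x≢j)) Gx) of λ ()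

-- With F = fill_i(τ) and t = τ ∩ V_i, the leading run of F is V[τ] ∩ V_i, so onLeadingRun t F is τ[0] ∩ V_i.
onLeadingRun : ∀ {k} → (Fin k → Bool) → (Fin k → Bool) → List Bool
onLeadingRun t F = take (leadingTrues (tabulate F)) (tabulate t)

countFin-gapped : ∀ {k} (g : Fin k → Bool) → countFin (gapped g) ≡ nonLeadingTrues (tabulate g)
countFin-gapped {zero}  g = refl
countFin-gapped {suc k} g with g zero
... | true  = countFin-gapped (g ∘ suc)
... | false = trans (countFin-cong (λ j → ∧-identityʳ (g (suc j)))) (countFin≡trues (g ∘ suc))

trues-onLeadingRun : ∀ {k} (f g : Fin k → Bool) → f ⊆ g →
  trues (onLeadingRun f g) ≡ countFin (λ j → f j ∧ not (gapBefore g j))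
trues-onLeadingRun {zero}  f g f⊆g = refl
trues-onLeadingRun {suc k} f g f⊆g with g zero in g₀
... | true  = cong₂ _+_ (cong ind (sym (∧-identityʳ (f zero)))) (trues-onLeadingRun (f ∘ suc) (g ∘ suc) (f⊆g ∘ suc))
... | false = sym (cong₂ _+_ (cong (λ b → ind (b ∧ true)) (⊆-false f⊆g zero g₀))
                             (countFin-allFalse (λ j → ∧-zeroʳ (f (suc j)))))

nonLeadingTrues-onLeadingRun : ∀ {k} (f g : Fin k → Bool) → f ⊆ g →
  nonLeadingTrues (onLeadingRun f g) ≡ countFin (λ j → f j ∧ not (gapBefore g j) ∧ gapBefore f j)
nonLeadingTrues-onLeadingRun {zero}  f g f⊆g = refl
nonLeadingTrues-onLeadingRun {suc k} f g f⊆g with g zero in g₀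
... | false = sym (cong₂ _+_ (cong ind (∧-zeroʳ (f zero))) (countFin-allFalse (λ j → ∧-zeroʳ (f (suc j)))))
... | true with f zero
...   | true  = nonLeadingTrues-onLeadingRun (f ∘ suc) (g ∘ suc) (f⊆g ∘ suc)
...   | false = trans (trues-onLeadingRun (f ∘ suc) (g ∘ suc) (f⊆g ∘ suc))
                      (countFin-cong (λ j → cong (f (suc j) ∧_) (sym (∧-identityʳ _))))

<ᵇ-irrefl : ∀ x → (x <ᵇ x) ≡ false
<ᵇ-irrefl zero    = refl
<ᵇ-irrefl (suc x) = <ᵇ-irrefl x

<⇒<ᵇ≡true : ∀ {x y} → x < y → (x <ᵇ y) ≡ true
<⇒<ᵇ≡true x<y = Equivalence.to T-≡ (<⇒<ᵇ x<y)

<ᵇ≡true⇒< : ∀ {x y} → (x <ᵇ y) ≡ true → x < y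
<ᵇ≡true⇒< {x} {y} p = <ᵇ⇒< x y (Equivalence.from T-≡ p)

-- f and g differ only on the leading run of g, so f covers that run iff |f| = |g|.
and-onLeadingRun : ∀ {k} (f g : Fin k → Bool) → f ⊆ g → gapped g ⊆ f →
  and (onLeadingRun f g) ≡ not (countFin f <ᵇ countFin g)
and-onLeadingRun {zero}  f g f⊆g gapped⊆f = refl
and-onLeadingRun {suc k} f g f⊆g gapped⊆f with g zero in g₀
... | false = sym (trans (cong (λ c → not (c <ᵇ countFin (g ∘ suc)))
                                (cong₂ _+_ (cong ind (⊆-false f⊆g zero g₀)) (countFin-cong f≗g)))
                         (cong not (<ᵇ-irrefl (countFin (g ∘ suc)))))
  where
  f≗g : ∀ j → f (suc j) ≡ g (suc j)
  f≗g j with g (suc j) in gj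
  ... | true  = gapped⊆f (suc j) (cong₂ (λ x y → x ∧ (not y ∨ gapBefore (g ∘ suc) j)) gj g₀)
  ... | false = ⊆-false f⊆g (suc j) gj
... | true with f zero in f₀
...   | true  = and-onLeadingRun (f ∘ suc) (g ∘ suc) (f⊆g ∘ suc)
                  (λ j p → gapped⊆f (suc j) (trans (cong (λ x → g (suc j) ∧ (not x ∨ gapBefore (g ∘ suc) j)) g₀) p))
...   | false = sym (cong not (<⇒<ᵇ≡true (s≤s (countFin-mono (f⊆g ∘ suc)))))

countFin-lexBlock : ∀ {k} (t F : Fin k → Bool) → t ⊆ F → gapped F ⊆ t → ∀ e →
  countFin (λ j → t j ∧ (gapBefore t j ∨ e)) ≡
  nonLeadingTrues (tabulate F) +
    (if e then trues (onLeadingRun t F) else nonLeadingTrues (onLeadingRun t F))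
countFin-lexBlock t F t⊆F gapped⊆t e =
  trans (countFin-split (λ j → t j ∧ (gapBefore t j ∨ e)) (gapBefore F))
        (cong₂ _+_ (trans (countFin-cong afterGap) (countFin-gapped F)) (beforeGap e))
  where
  onGapped : ∀ x y gx gy → (gy ≡ true → gx ≡ true) → (x ≡ true → y ≡ true) → (y ∧ gy ≡ true → x ≡ true) →
             (x ∧ (gx ∨ e)) ∧ gy ≡ y ∧ gy
  onGapped _     _     _     false _  _  _  = trans (∧-zeroʳ _) (sym (∧-zeroʳ _))
  onGapped true  true  true  true  _  _  _  = refl
  onGapped false false true  true  _  _  _  = refl
  onGapped true  false _     true  _  h₂ _  = case h₂ refl of λ ()
  onGapped false true  _     true  _  _  h₃ = case h₃ refl of λ ()
  onGapped _     _     false true  h₁ _  _  = case h₁ refl of λ ()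

  afterGap : ∀ j → (t j ∧ (gapBefore t j ∨ e)) ∧ gapBefore F j ≡ gapped F j
  afterGap j = onGapped (t j) (F j) (gapBefore t j) (gapBefore F j)
                 (gapBefore-antitone t⊆F j) (t⊆F j) (gapped⊆t j)

  beforeGap : ∀ e → countFin (λ j → (t j ∧ (gapBefore t j ∨ e)) ∧ not (gapBefore F j)) ≡
    (if e then trues (onLeadingRun t F) else nonLeadingTrues (onLeadingRun t F))
  beforeGap true  = trans (countFin-cong pointwise) (sym (trues-onLeadingRun t F t⊆F))
    where
    pointwise : ∀ j → (t j ∧ (gapBefore t j ∨ true)) ∧ not (gapBefore F j) ≡ t j ∧ not (gapBefore F j)
    pointwise j rewrite ∨-zeroʳ (gapBefore t j) | ∧-identityʳ (t j) = refl
  beforeGap false = trans (countFin-cong pointwise) (sym (nonLeadingTrues-onLeadingRun t F t⊆F))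
    where
    table : ∀ x gx ngy → (x ∧ (gx ∨ false)) ∧ ngy ≡ x ∧ ngy ∧ gx
    table false _     _     = refl
    table true  true  ngy   = sym (∧-identityʳ ngy)
    table true  false ngy   = sym (∧-zeroʳ ngy)
    pointwise : ∀ j → (t j ∧ (gapBefore t j ∨ false)) ∧ not (gapBefore F j) ≡
                      t j ∧ not (gapBefore F j) ∧ gapBefore t j
    pointwise j = table (t j) (gapBefore t j) (not (gapBefore F j))

module Lex (m : ℕ) (n a : Fin m → ℕ) (d : ℕ) where
  open Setup m n a d

  _≟ⱽ_ : DecidableEquality Vtx
  _≟ⱽ_ = ≡-dec _≟ᶠ_ _≟ᶠ_

  block : VSubset → (i : Fin m) → Fin (n i) → Bool
  block σ i j = σ (i , j)

  set : VSubset → Vtx → Bool → VSubset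
  set = update _≟ⱽ_

  block-set : ∀ σ i j b j' → block (set σ (i , j) b) i j' ≡ update _≟ᶠ_ (block σ i) j b j'
  block-set σ i j b j' = case j' ≟ᶠ j of λ where
    (yes refl) → trans (update-same _≟ⱽ_ σ (i , j) b) (sym (update-same _≟ᶠ_ (block σ i) j b))
    (no j'≢j)  → trans (update-other _≟ⱽ_ σ (i , j) b (i , j') (λ { refl → j'≢j refl }))
                       (sym (update-other _≟ᶠ_ (block σ i) j b j' j'≢j))

  blockCount-set-other : ∀ σ i j b i' → i' ≢ i → blockCount (set σ (i , j) b) i' ≡ blockCount σ i'
  blockCount-set-other σ i j b i' i'≢i =
    countFin-cong λ j' → update-other _≟ⱽ_ σ (i , j) b (i' , j') (i'≢i ∘ cong proj₁)

  blockCount-remove : ∀ σ i j → σ (i , j) ≡ true → blockCount (set σ (i , j) false) i + 1 ≡ blockCount σ i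
  blockCount-remove σ i j σv = trans (cong (_+ 1) (countFin-cong (block-set σ i j false)))
                                     (countFin-remove (block σ i) j σv)

  blockCount-insert : ∀ σ i j → σ (i , j) ≡ false → blockCount σ i + 1 ≡ blockCount (set σ (i , j) true) i
  blockCount-insert σ i j σv = trans (countFin-insert (block σ i) j σv)
                                     (sym (countFin-cong (block-set σ i j true)))

  size-remove : ∀ σ i j → σ (i , j) ≡ true → size (set σ (i , j) false) + 1 ≡ size σ
  size-remove σ i j σv = sumFin-bumpAt _ (blockCount σ) i
    (λ i' i'≢i → blockCount-set-other σ i j false i' i'≢i) (blockCount-remove σ i j σv)

  size-insert : ∀ σ i j → σ (i , j) ≡ false → size σ + 1 ≡ size (set σ (i , j) true)
  size-insert σ i j σv = sumFin-bumpAt (blockCount σ) _ i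
    (λ i' i'≢i → sym (blockCount-set-other σ i j true i' i'≢i)) (blockCount-insert σ i j σv)

  size-mono : ∀ σ ρ → (∀ v → σ v ≡ true → ρ v ≡ true) → size σ ≤ size ρ
  size-mono σ ρ σ⊆ρ = sumFin-mono (λ i → countFin-mono (λ j → σ⊆ρ (i , j)))

  After-irrefl : ∀ v → ¬ After v v
  After-irrefl (i , j) (inj₁ i<i)       = <-irrefl refl i<i
  After-irrefl (i , j) (inj₂ (_ , j<j)) = <-irrefl refl j<j

  After-asym : ∀ u v → After u v → ¬ After v u
  After-asym (i , j) (i' , j') (inj₁ p)           (inj₁ q)           = <-asym p q
  After-asym (i , j) (i' , j') (inj₁ p)           (inj₂ (refl , _))  = <-irrefl refl p
  After-asym (i , j) (i' , j') (inj₂ (refl , _))  (inj₁ q)           = <-irrefl refl q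
  After-asym (i , j) (i' , j') (inj₂ (refl , p))  (inj₂ (_ , q))     = <-asym p q

  exchange⇒RLex : ∀ τ → IsFacet τ → ∀ v w → τ v ≡ true → τ w ≡ false → After w v →
                  proj₁ w ≡ proj₁ v ⊎ blockCount τ (proj₁ w) < a (proj₁ w) → RLex τ v
  exchange⇒RLex τ (τ≤a , |τ|) v@(iv , jv) w@(iw , jw) τv τw w≻v room =
    τv , τ' , (τ'≤a , |τ'|) , (v , τv , τ'v , agree) , τ-v⊆τ'
    where
    τ₁ = set τ v false
    τ' = set τ₁ w true

    w≢v : w ≢ v
    w≢v refl = After-irrefl w w≻v

    τ₁w : τ₁ w ≡ false
    τ₁w = trans (update-other _≟ⱽ_ τ v false w w≢v) τw

    |τ'| : size τ' ≡ d
    |τ'| = trans (sym (size-insert τ₁ iw jw τ₁w)) (trans (size-remove τ iv jv τv) |τ|)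

    τ₁⊆τ : ∀ i → block τ₁ i ⊆ block τ i
    τ₁⊆τ i j p = case (i , j) ≟ⱽ v of λ where
      (yes refl) → case trans (sym p) (update-same _≟ⱽ_ τ v false) of λ ()
      (no ne)    → trans (sym (update-other _≟ⱽ_ τ v false (i , j) ne)) p

    roomForW : blockCount τ₁ iw + 1 ≤ a iw
    roomForW = [ sameBlock , otherBlock ]′ room
      where
      sameBlock : iw ≡ iv → blockCount τ₁ iw + 1 ≤ a iw
      sameBlock iw≡iv = subst (λ i → blockCount τ₁ i + 1 ≤ a i) (sym iw≡iv)
                              (≤-trans (≤-reflexive (blockCount-remove τ iv jv τv)) (τ≤a iv))
      otherBlock : blockCount τ iw < a iw → blockCount τ₁ iw + 1 ≤ a iw
      otherBlock roomy = ≤-trans (+-monoˡ-≤ 1 (countFin-mono (τ₁⊆τ iw))) (≤-trans (≤-reflexive (+-comm _ 1)) roomy)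

    τ'≤a : ∀ i → blockCount τ' i ≤ a i
    τ'≤a i = case i ≟ᶠ iw of λ where
      (yes refl) → ≤-trans (≤-reflexive (sym (blockCount-insert τ₁ iw jw τ₁w))) roomForW
      (no i≢iw)  → ≤-trans (≤-reflexive (blockCount-set-other τ₁ iw jw true i i≢iw))
                           (≤-trans (countFin-mono (τ₁⊆τ i)) (τ≤a i))

    τ'v : τ' v ≡ false
    τ'v = trans (update-other _≟ⱽ_ τ₁ w true v (w≢v ∘ sym)) (update-same _≟ⱽ_ τ v false)

    agree : ∀ u → After v u → τ' u ≡ τ u
    agree u v≻u = trans (update-other _≟ⱽ_ τ₁ w true u u≢w) (update-other _≟ⱽ_ τ v false u u≢v)
      where
      u≢w : u ≢ w
      u≢w refl = After-asym w v w≻v v≻u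
      u≢v : u ≢ v
      u≢v refl = After-irrefl v v≻u

    τ-v⊆τ' : ∀ u → τ u ≡ true → u ≢ v → τ' u ≡ true
    τ-v⊆τ' u τu u≢v = case u ≟ⱽ w of λ where
      (yes refl) → update-same _≟ⱽ_ τ₁ w true
      (no u≢w)   → trans (update-other _≟ⱽ_ τ₁ w true u u≢w) (trans (update-other _≟ⱽ_ τ v false u u≢v) τu)

  After-trichotomy : ∀ u v → After u v ⊎ u ≡ v ⊎ After v u
  After-trichotomy (i , j) (i' , j') with <-cmpᶠ i i'
  ... | tri< i<i' _ _ = inj₁ (inj₁ i<i')
  ... | tri> _ _ i'<i = inj₂ (inj₂ (inj₁ i'<i))
  ... | tri≈ _ refl _ with <-cmpᶠ j j'
  ...   | tri< j<j' _ _ = inj₁ (inj₂ (refl , j<j'))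
  ...   | tri≈ _ refl _ = inj₂ (inj₁ refl)
  ...   | tri> _ _ j'<j = inj₂ (inj₂ (inj₂ (refl , j'<j)))

  loss⇒gain : ∀ σ ρ v → σ v ≡ true → ρ v ≡ false → size σ ≤ size ρ → ∃ λ w → ρ w ≡ true × σ w ≡ false
  loss⇒gain σ ρ v@(iv , jv) σv ρv |σ|≤|ρ|
    with any? (λ i → any? (λ j → ρ (i , j) ∧ not (σ (i , j)) ≟ᵇ true))
  ... | yes (i , j , gain) = (i , j) , ∧-conicalˡ _ _ gain , not-injective (∧-conicalʳ _ _ gain)
  ... | no  none           = ⊥-elim (<-irrefl refl (≤-<-trans |σ|≤|ρ| |ρ|<|σ|))
    where
    σ₁ = set σ v false
    ρ⊆σ : ∀ u → ρ u ≡ true → σ u ≡ true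
    ρ⊆σ (i , j) ρu = ¬-not (λ σu → none (i , j , ∧-intro ρu (cong not σu)))
    ρ⊆σ₁ : ∀ u → ρ u ≡ true → σ₁ u ≡ true
    ρ⊆σ₁ u ρu = case u ≟ⱽ v of λ where
      (yes refl) → case trans (sym ρu) ρv of λ ()
      (no u≢v)   → trans (update-other _≟ⱽ_ σ v false u u≢v) (ρ⊆σ u ρu)
    |ρ|<|σ| : size ρ < size σ
    |ρ|<|σ| = ≤-trans (s≤s (size-mono ρ σ₁ ρ⊆σ₁))
                (≤-reflexive (trans (+-comm 1 (size σ₁)) (size-remove σ iv jv σv)))

  deficient : VSubset → Fin m → Bool
  deficient τ i = blockCount τ i <ᵇ a i

  rlex : VSubset → VSubset
  rlex τ (i , j) = τ (i , j) ∧ (gapBefore (block τ i) j ∨ anyBefore (deficient τ) i)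

  rlex⇒RLex : (∀ i → a i ≤ n i) → ∀ τ → IsFacet τ → ∀ v → rlex τ v ≡ true → RLex τ v
  rlex⇒RLex a≤n τ fac v@(i , j) v∈rlex with gapBefore (block τ i) j in gap
  ... | true with gapBefore-sound (block τ i) j gap
  ...   | j' , j'<j , τj' = exchange⇒RLex τ fac v (i , j') τv τj' (inj₂ (refl , j'<j)) (inj₁ refl)
    where τv = ∧-conicalˡ _ _ v∈rlex
  rlex⇒RLex a≤n τ fac v@(i , j) v∈rlex | false
    with anyBefore-sound (deficient τ) i (∧-conicalʳ (τ v) _ v∈rlex)
  ... | i' , i'<i , def with countFin<⇒∃false (block τ i') (<-≤-trans (<ᵇ≡true⇒< def) (a≤n i'))
  ...   | j' , τj' = exchange⇒RLex τ fac v (i' , j') (∧-conicalˡ _ _ v∈rlex) τj' (inj₁ i'<i) (inj₂ (<ᵇ≡true⇒< def))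

  RLex⇒rlex : ∀ τ → IsFacet τ → ∀ v → RLex τ v → rlex τ v ≡ true
  RLex⇒rlex τ fac v@(iv , jv) (τv , τ' , fac' , (u , τu , τ'u , agree) , τ-v⊆τ') with u ≟ⱽ v
  ... | no u≢v   = case trans (sym (τ-v⊆τ' u τu u≢v)) τ'u of λ ()
  ... | yes refl with loss⇒gain τ τ' v τv τ'u (≤-reflexive (trans (proj₂ fac) (sym (proj₂ fac'))))
  ...   | w@(iw , jw) , τ'w , τw with After-trichotomy v w
  ...     | inj₁ v≻w                    = case trans (sym τ'w) (trans (agree w v≻w) τw) of λ ()
  ...     | inj₂ (inj₁ refl)            = case trans (sym τ'w) τ'u of λ ()
  ...     | inj₂ (inj₂ (inj₂ (refl , jw<jv))) =
    ∧-intro τv (∨-introˡ _ (gapBefore-complete (block τ iv) jv jw jw<jv τw))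
  ...     | inj₂ (inj₂ (inj₁ iw<iv)) =
    ∧-intro τv (∨-introʳ _ (anyBefore-complete (deficient τ) iv iw iw<iv (<⇒<ᵇ≡true |τᵢw|<a)))
    where
    τᵢw⊆τ'ᵢw : block τ iw ⊆ block τ' iw
    τᵢw⊆τ'ᵢw j τj = τ-v⊆τ' (iw , j) τj (λ { refl → <-irrefl refl iw<iv })
    |τᵢw|<a : blockCount τ iw < a iw
    |τᵢw|<a = <-≤-trans (countFin-strict τᵢw⊆τ'ᵢw jw τw τ'w) (proj₁ fac' iw)

  degΦ≡ : ∀ F τ → degΦ F τ ≡ length (Φ0 F τ) + sumFin (length ∘ Φi F)
  degΦ≡ F τ = trans (length-++ (map (0 ,′_) (Φ0 F τ)))
    (cong₂ _+_ (length-map (0 ,′_) (Φ0 F τ))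
               (trans (length-concat (λ i → map (ℕ.suc (toℕ i) ,′_) (Φi F i)))
                      (sumFin-cong λ i → length-map (ℕ.suc (toℕ i) ,′_) (Φi F i))))

  module _ (τ : VSubset) (F : (i : Fin m) → Fin (n i) → Bool) (fill : ∀ i → IsFill τ i (F i)) where

    τ[0]ᵢ : Fin m → List Bool
    τ[0]ᵢ i = onLeadingRun (block τ i) (F i)

    |Fᵢ| : ∀ i → countFin (F i) ≡ a i
    |Fᵢ| i = proj₁ (fill i)

    τᵢ⊆Fᵢ : ∀ i → block τ i ⊆ F i
    τᵢ⊆Fᵢ i = proj₁ (proj₂ (fill i))

    gapped⊆τᵢ : ∀ i → gapped (F i) ⊆ block τ i
    gapped⊆τᵢ i = revlexFirst-gapped⊆ (block τ i) (F i) (a i) (|Fᵢ| i) (τᵢ⊆Fᵢ i) (proj₂ (proj₂ (fill i)))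

    a∸degΦᵢ≡leadingRun : ∀ i → a i ∸ length (Φi F i) ≡ leadingTrues (tabulate (F i))
    a∸degΦᵢ≡leadingRun i = begin
      a i ∸ length (Φi F i)                ≡⟨ cong₂ _∸_ (sym (|Fᵢ| i)) (length-φ Fᵢ) ⟩
      countFin (F i) ∸ nonLeadingTrues Fᵢ  ≡⟨ cong (_∸ nonLeadingTrues Fᵢ)
                                                   (trans (countFin≡trues (F i)) (trues≡leading+nonLeading Fᵢ)) ⟩
      leadingTrues Fᵢ + nonLeadingTrues Fᵢ ∸ nonLeadingTrues Fᵢ ≡⟨ m+n∸n≡m (leadingTrues Fᵢ) (nonLeadingTrues Fᵢ) ⟩
      leadingTrues Fᵢ                      ∎
      where
      open ≡-Reasoning
      Fᵢ = tabulate (F i)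

    τ0list≡ : τ0list F τ ≡ concat (tabulate τ[0]ᵢ)
    τ0list≡ = cong concat (tabulate-cong λ i → cong (λ r → take r (tabulate (block τ i))) (a∸degΦᵢ≡leadingRun i))

    deficient≡ : ∀ i → deficient τ i ≡ not (and (τ[0]ᵢ i))
    deficient≡ i = begin
      blockCount τ i <ᵇ a i                            ≡⟨ cong (blockCount τ i <ᵇ_) (|Fᵢ| i) ⟨
      countFin (block τ i) <ᵇ countFin (F i)             ≡⟨ not-involutive _ ⟨
      not (not (countFin (block τ i) <ᵇ countFin (F i))) ≡⟨ cong not (and-onLeadingRun _ _ (τᵢ⊆Fᵢ i) (gapped⊆τᵢ i)) ⟨
      not (and (τ[0]ᵢ i))                              ∎
      where open ≡-Reasoning

    τ[0]-count : Fin m → ℕ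
    τ[0]-count i = if anyBefore (deficient τ) i then trues (τ[0]ᵢ i) else nonLeadingTrues (τ[0]ᵢ i)

    blockCount-rlex : ∀ i → blockCount (rlex τ) i ≡ length (Φi F i) + τ[0]-count i
    blockCount-rlex i =
      trans (countFin-lexBlock (block τ i) (F i) (τᵢ⊆Fᵢ i) (gapped⊆τᵢ i) (anyBefore (deficient τ) i))
            (cong (_+ τ[0]-count i) (sym (length-φ (tabulate (F i)))))

    degΦ₀≡ : length (Φ0 F τ) ≡ sumFin τ[0]-count
    degΦ₀≡ = begin
      length (Φ0 F τ)                          ≡⟨ length-φ (τ0list F τ) ⟩
      nonLeadingTrues (τ0list F τ)             ≡⟨ cong nonLeadingTrues τ0list≡ ⟩
      nonLeadingTrues (concat (tabulate τ[0]ᵢ)) ≡⟨ nonLeadingTrues-concat τ[0]ᵢ ⟩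
      sumFin (λ i → if anyBefore (not ∘ and ∘ τ[0]ᵢ) i then trues (τ[0]ᵢ i) else nonLeadingTrues (τ[0]ᵢ i))
        ≡⟨ sumFin-cong (λ i → cong (λ b → if b then trues (τ[0]ᵢ i) else nonLeadingTrues (τ[0]ᵢ i))
                                    (anyBefore-cong (sym ∘ deficient≡) i)) ⟩
      sumFin τ[0]-count                        ∎
      where open ≡-Reasoning

    size-rlex : size (rlex τ) ≡ degΦ F τ
    size-rlex = begin
      size (rlex τ)                                   ≡⟨ sumFin-cong blockCount-rlex ⟩
      sumFin (λ i → length (Φi F i) + τ[0]-count i)   ≡⟨ sumFin-+ (length ∘ Φi F) τ[0]-count ⟩
      sumFin (length ∘ Φi F) + sumFin τ[0]-count      ≡⟨ +-comm (sumFin (length ∘ Φi F)) _ ⟩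
      sumFin τ[0]-count + sumFin (length ∘ Φi F)      ≡⟨ cong (_+ sumFin (length ∘ Φi F)) degΦ₀≡ ⟨
      length (Φ0 F τ) + sumFin (length ∘ Φi F)        ≡⟨ degΦ≡ F τ ⟨
      degΦ F τ                                        ∎
      where open ≡-Reasoning

lemma6p6 : (m : ℕ) (n a : Fin m → ℕ) (d : ℕ) →
    (∀ i → a i ≤ n i) → 1 ≤ d → d ≤ sumFin a →
    (τ : Setup.VSubset m n a d) → Setup.IsFacet m n a d τ →
    (F : (i : Fin m) → Fin (n i) → Bool) → (∀ i → Setup.IsFill m n a d τ i (F i)) →
    Setup.HasCard m n a d (Setup.RLex m n a d τ) (Setup.degΦ m n a d F τ)
lemma6p6 m n a d a≤n _ _ τ facet F fill =
  rlex τ , (λ v → rlex⇒RLex a≤n τ facet v , RLex⇒rlex τ facet v) , size-rlex τ F fill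
  where open Lex m n a d
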